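{- For any signature morphism $\chi$ in $\mathcal{I}$, $[\chi]$ is $p\mathit{Mod}$-strict in $\frac{3}{2}\mathcal{I}$: for each $\varphi\in p\mathit{Sign}$ whose codomain equals the domain of $\chi$, $p\mathit{Mod}([\chi]);p\mathit{Mod}(\varphi)=p\mathit{Mod}(\varphi;[\chi])$.
   Context: $\mathcal{I}=(\mathit{Sign},\mathit{Sen},\mathit{Mod},\models)$ is an institution with an inclusion system on $\mathit{Sign}$, pullbacks of semi-inclusive cospans and inclusive $\mathit{Sen}$; $\frac{3}{2}\mathcal{I}=(p\mathit{Sign},p\mathit{Sen},p\mathit{Mod},\models)$ is built from partial signature morphisms $\varphi\colon\Sigma\rightharpoonup\Sigma'$ (a $\mathit{Sign}$-morphism $\varphi^0\colon\mathrm{dom}\,\varphi\to\Sigma'$ with $\mathrm{dom}\,\varphi\subseteq\Sigma$, composed via unique semi-inclusive pullbacks), with $p\mathit{Mod}(\Sigma)=\mathit{Mod}(\Sigma)$ and $p\mathit{Mod}(\varphi)M'=\{M\in|\mathit{Mod}(\Sigma)|\mid\mathit{Mod}(\mathrm{dom}\,\varphi\subseteq\Sigma)M=\mathit{Mod}(\varphi^0)M'\}$. $[\_]\colon\mathit{Sign}\to p\mathit{Sign}$ is the canonical embedding with $[\chi]^0=\chi$. In a $\frac{3}{2}$-institution a signature morphism $\varphi$ is $\mathit{Mod}$-strict when for each signature morphism $\theta$ whose codomain equals the domain of $\varphi$, $\mathit{Mod}(\varphi);\mathit{Mod}(\theta)=\mathit{Mod}(\theta;\varphi)$. -}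

module Defs where

open import Level using (Level; _⊔_) renaming (suc to lsuc)
open import Data.Product using (Σ; _×_; _,_; proj₁; proj₂)
open import Relation.Binary.PropositionalEquality using (_≡_; subst)

-- Categories (hom-sets with strict equality), composition written
-- diagrammatically:  f ⨾ g  means "first f, then g".

record Category (o h : Level) : Set (lsuc (o ⊔ h)) where
  infixr 9 _⨾_
  field
    Obj   : Set o
    Hom   : Obj → Obj → Set h
    id    : ∀ {A} → Hom A A
    _⨾_   : ∀ {A B C} → Hom A B → Hom B C → Hom A C
    idˡ   : ∀ {A B} (f : Hom A B) → id ⨾ f ≡ f
    idʳ   : ∀ {A B} (f : Hom A B) → f ⨾ id ≡ f
    assoc : ∀ {A B C D} (f : Hom A B) (g : Hom B C) (k : Hom C D) →
            (f ⨾ g) ⨾ k ≡ f ⨾ (g ⨾ k)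

module _ {o h : Level} (C : Category o h) where
  open Category C

  record IsPullback {A B C' D : Obj} (f : Hom A B) (g : Hom C' B)
                    (a : Hom D A) (b : Hom D C') : Set (o ⊔ h) where
    field
      commutes  : a ⨾ f ≡ b ⨾ g
      universal : ∀ {X} (x : Hom X A) (y : Hom X C') → x ⨾ f ≡ y ⨾ g →
                  Σ (Hom X D) λ u → (u ⨾ a ≡ x) × (u ⨾ b ≡ y)
      unique    : ∀ {X} (u v : Hom X D) → u ⨾ a ≡ v ⨾ a → u ⨾ b ≡ v ⨾ b → u ≡ v

-- Inclusion systems  ⟨I, E⟩ : I a partial order (given as a thin,
-- antisymmetric relation _⊆_ together with the arrows ι realising it),
-- E a subcategory, and every arrow factors uniquely as  e ⨾ i  with
-- e ∈ E, i ∈ I.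

record InclusionSystem {o h : Level} (C : Category o h) : Set (lsuc (o ⊔ h)) where
  open Category C
  field
    _⊆_       : Obj → Obj → Set h
    ⊆-prop    : ∀ {A B} (p q : A ⊆ B) → p ≡ q
    ⊆-refl    : ∀ {A} → A ⊆ A
    ⊆-trans   : ∀ {A B D} → A ⊆ B → B ⊆ D → A ⊆ D
    ⊆-antisym : ∀ {A B} → A ⊆ B → B ⊆ A → A ≡ B
    ι         : ∀ {A B} → A ⊆ B → Hom A B
    ι-refl    : ∀ {A} → ι (⊆-refl {A}) ≡ id
    ι-trans   : ∀ {A B D} (p : A ⊆ B) (q : B ⊆ D) → ι (⊆-trans p q) ≡ ι p ⨾ ι q
    E         : ∀ {A B} → Hom A B → Set h
    E-id      : ∀ {A} → E (id {A})
    E-comp    : ∀ {A B D} {e : Hom A B} {e' : Hom B D} → E e → E e' → E (e ⨾ e')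
    factor    : ∀ {A B} (f : Hom A B) →
                Σ Obj λ D → Σ (Hom A D) λ e → E e × Σ (D ⊆ B) λ p → f ≡ e ⨾ ι p
    factor-unique : ∀ {A B D D'} (e : Hom A D) (e' : Hom A D')
                    (p : D ⊆ B) (p' : D' ⊆ B) → E e → E e' →
                    e ⨾ ι p ≡ e' ⨾ ι p' →
                    Σ (D ≡ D') λ eq → subst (Hom A) eq e ≡ e'

-- Institutions (model "classes" given by their objects; reducts act on
-- objects of model categories)

record Institution (o h s m ℓ : Level) : Set (lsuc (o ⊔ h ⊔ s ⊔ m ⊔ ℓ)) where
  field
    Sign : Category o h
  open Category Sign
  field
    Sen    : Obj → Set s
    Sen₁   : ∀ {A B} → Hom A B → Sen A → Sen B
    Sen-id : ∀ {A} (ρ : Sen A) → Sen₁ (id {A}) ρ ≡ ρ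
    Sen-⨾  : ∀ {A B D} (f : Hom A B) (g : Hom B D) (ρ : Sen A) →
             Sen₁ (f ⨾ g) ρ ≡ Sen₁ g (Sen₁ f ρ)
    Mod    : Obj → Set m
    Mod₁   : ∀ {A B} → Hom A B → Mod B → Mod A
    Mod-id : ∀ {A} (M : Mod A) → Mod₁ (id {A}) M ≡ M
    Mod-⨾  : ∀ {A B D} (f : Hom A B) (g : Hom B D) (M : Mod D) →
             Mod₁ (f ⨾ g) M ≡ Mod₁ f (Mod₁ g M)
    _⊨_    : ∀ {A} → Mod A → Sen A → Set ℓ
    satisfaction : ∀ {A B} (f : Hom A B) (M' : Mod B) (ρ : Sen A) →
                   (M' ⊨ Sen₁ f ρ → Mod₁ f M' ⊨ ρ) × (Mod₁ f M' ⊨ ρ → M' ⊨ Sen₁ f ρ)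

module _ {o h : Level} (C : Category o h) (IS : InclusionSystem C) where
  open Category C
  open InclusionSystem IS

  record SIPullback {A B C' : Obj} (f : Hom A B) (p : C' ⊆ B) : Set (o ⊔ h) where
    field
      apex  : Obj
      apex⊆ : apex ⊆ A
      leg   : Hom apex C'
      isPB  : IsPullback C f (ι p) (ι apex⊆) leg

record Setting (o h s m ℓ : Level) : Set (lsuc (o ⊔ h ⊔ s ⊔ m ⊔ ℓ)) where
  field
    inst : Institution o h s m ℓ
    incl : InclusionSystem (Institution.Sign inst)
  open Institution inst
  open Category Sign
  open InclusionSystem incl
  open SIPullback
  field
    pb        : ∀ {A B C'} (f : Hom A B) (p : C' ⊆ B) → SIPullback Sign incl f p
    pb-unique : ∀ {A B C'} (f : Hom A B) (p : C' ⊆ B) (P : SIPullback Sign incl f p) →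
                Σ (apex P ≡ apex (pb f p)) λ eq →
                  subst (λ D → Hom D C') eq (leg P) ≡ leg (pb f p)

module ThreeHalves {o h s m ℓ : Level} (𝒮 : Setting o h s m ℓ) where
  open Setting 𝒮 public
  open Institution inst public
  open Category Sign public
  open InclusionSystem incl public
  open SIPullback public

  record PHom (S S' : Obj) : Set (o ⊔ h) where
    constructor pmor
    field
      dom  : Obj
      dom⊆ : dom ⊆ S
      mor  : Hom dom S'
  open PHom public

  _⨾ₚ_ : ∀ {S S' S''} → PHom S S' → PHom S' S'' → PHom S S''
  φ ⨾ₚ θ = pmor (apex P) (⊆-trans (apex⊆ P) (dom⊆ φ)) (leg P ⨾ mor θ)
    where P = pb (mor φ) (dom⊆ θ)

  [_] : ∀ {S S'} → Hom S S' → PHom S S'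
  [ χ ] = pmor _ ⊆-refl χ

  pMod : Obj → Set m
  pMod = Mod

  -- pMod(φ) M' = { M ∈ Mod(S) | Mod(dom φ ⊆ S) M = Mod(φ⁰) M' }
  -- (a multi-valued map, i.e. a set-valued function)
  pMod₁ : ∀ {S S'} → PHom S S' → pMod S' → pMod S → Set m
  pMod₁ φ M' M = Mod₁ (ι (dom⊆ φ)) M ≡ Mod₁ (mor φ) M'

  _⨟ₘ_ : ∀ {X Y Z : Set m} → (X → Y → Set m) → (Y → Z → Set m) → X → Z → Set m
  (F ⨟ₘ G) x z = Σ _ λ y → F x y × G y z

  _≐_ : ∀ {X Z : Set m} → (X → Z → Set m) → (X → Z → Set m) → Set m
  F ≐ G = ∀ x z → (F x z → G x z) × (G x z → F x z)

  IsPModStrict : ∀ {S' S''} → PHom S' S'' → Set (o ⊔ h ⊔ m)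
  IsPModStrict {S'} ψ = ∀ {S} (θ : PHom S S') → (pMod₁ ψ ⨟ₘ pMod₁ θ) ≐ pMod₁ (θ ⨾ₚ ψ)

-- Pulling a partial morphism θ back along an identity inclusion does nothing, so by
-- uniqueness of semi-inclusive pullbacks θ ⨾ₚ [χ] is θ with χ postcomposed to its
-- total part. Moreover pMod [χ] is single-valued with value Mod χ, so
-- pMod [χ] ⨟ pMod θ collapses to pMod θ ∘ Mod χ, which is pMod (θ ⨾ₚ [χ])
-- by functoriality of Mod.
module Submission where

open import Level using (Level)
open import Defs
open import Data.Product using (_×_; _,_; proj₁; proj₂)
open import Relation.Binary.PropositionalEquality hiding ([_])

module Strictness {o h s m ℓ : Level} (𝒮 : Setting o h s m ℓ) where
  open ThreeHalves 𝒮

  coerce : ∀ {A B : Set m} → A ≡ B → A → B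
  coerce = subst (λ T → T)

  ⨾-ι-refl : ∀ {A B} (f : Hom A B) → f ⨾ ι ⊆-refl ≡ f
  ⨾-ι-refl f = trans (cong (f ⨾_) ι-refl) (idʳ f)

  ι-refl-⨾ : ∀ {A B} (f : Hom A B) → ι ⊆-refl ⨾ f ≡ f
  ι-refl-⨾ f = trans (cong (_⨾ f) ι-refl) (idˡ f)

  Mod₁-ι-refl : ∀ {A} (M : Mod A) → Mod₁ (ι ⊆-refl) M ≡ M
  Mod₁-ι-refl M = trans (cong (λ f → Mod₁ f M) ι-refl) (Mod-id M)

  isPullback-along-ι-refl : ∀ {A B} (f : Hom A B) →
                            IsPullback Sign f (ι ⊆-refl) (ι ⊆-refl) f
  isPullback-along-ι-refl f = record
    { commutes  = trans (ι-refl-⨾ f) (sym (⨾-ι-refl f))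
    ; universal = λ x y x⨾f≡y → x , ⨾-ι-refl x , trans x⨾f≡y (⨾-ι-refl y)
    ; unique    = λ u v u≡v _ → trans (sym (⨾-ι-refl u)) (trans u≡v (⨾-ι-refl v))
    }

  sipb-along-⊆-refl : ∀ {A B} (f : Hom A B) → SIPullback Sign incl f ⊆-refl
  sipb-along-⊆-refl f = record
    { apex⊆ = ⊆-refl ; leg = f ; isPB = isPullback-along-ι-refl f }

  ⨾ₚ-[] : ∀ {S S' S''} (θ : PHom S S') (χ : Hom S' S'') →
          θ ⨾ₚ [ χ ] ≡ pmor (dom θ) (dom⊆ θ) (mor θ ⨾ χ)
  ⨾ₚ-[] {S' = S'} θ χ with pb (mor θ) ⊆-refl | pb-unique (mor θ) ⊆-refl (sipb-along-⊆-refl (mor θ))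
  ... | P | apex≡ , leg≡ = collapse (apex⊆ P) (leg P) apex≡ leg≡
    where
      collapse : ∀ {A} (a : A ⊆ dom θ) (l : Hom A S') (eq : dom θ ≡ A) →
                 subst (λ D → Hom D S') eq (mor θ) ≡ l →
                 pmor A (⊆-trans a (dom⊆ θ)) (l ⨾ χ) ≡ pmor (dom θ) (dom⊆ θ) (mor θ ⨾ χ)
      collapse a _ refl refl =
        cong (λ d → pmor (dom θ) d (mor θ ⨾ χ)) (⊆-prop (⊆-trans a (dom⊆ θ)) (dom⊆ θ))

  pMod₁-[] : ∀ {S' S''} (χ : Hom S' S'') (M'' : Mod S'') (M' : Mod S') →
             pMod₁ [ χ ] M'' M' ≡ (M' ≡ Mod₁ χ M'')
  pMod₁-[] χ M'' M' = cong (_≡ Mod₁ χ M'') (Mod₁-ι-refl M')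

  pMod₁-⨾ₚ-[] : ∀ {S S' S''} (θ : PHom S S') (χ : Hom S' S'') (M'' : Mod S'') (M : Mod S) →
                pMod₁ (θ ⨾ₚ [ χ ]) M'' M ≡ pMod₁ θ (Mod₁ χ M'') M
  pMod₁-⨾ₚ-[] θ χ M'' M = begin
    pMod₁ (θ ⨾ₚ [ χ ]) M'' M                             ≡⟨ cong (λ φ → pMod₁ φ M'' M) (⨾ₚ-[] θ χ) ⟩
    (Mod₁ (ι (dom⊆ θ)) M ≡ Mod₁ (mor θ ⨾ χ) M'')         ≡⟨ cong (Mod₁ (ι (dom⊆ θ)) M ≡_) (Mod-⨾ (mor θ) χ M'') ⟩
    pMod₁ θ (Mod₁ χ M'') M                               ∎
    where open ≡-Reasoning

  ⨟ₘ-graph : ∀ {X Y Z : Set m} (f : X → Y) (F : X → Y → Set m) (G : Y → Z → Set m) →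
             (∀ x y → F x y ≡ (y ≡ f x)) →
             ∀ x z → ((F ⨟ₘ G) x z → G (f x) z) × (G (f x) z → (F ⨟ₘ G) x z)
  ⨟ₘ-graph f F G F≡graph x z = to , from
    where
      to : (F ⨟ₘ G) x z → G (f x) z
      to (y , Fxy , Gyz) = subst (λ y → G y z) (coerce (F≡graph x y) Fxy) Gyz

      from : G (f x) z → (F ⨟ₘ G) x z
      from Gfxz = f x , coerce (sym (F≡graph x (f x))) refl , Gfxz

  [_]-isPModStrict : ∀ {S' S''} (χ : Hom S' S'') → IsPModStrict [ χ ]
  [ χ ]-isPModStrict θ M'' M = (λ p → coerce (sym eq) (to p)) , (λ p → from (coerce eq p))
    where
      eq : pMod₁ (θ ⨾ₚ [ χ ]) M'' M ≡ pMod₁ θ (Mod₁ χ M'') M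
      eq = pMod₁-⨾ₚ-[] θ χ M'' M

      to : (pMod₁ [ χ ] ⨟ₘ pMod₁ θ) M'' M → pMod₁ θ (Mod₁ χ M'') M
      to = proj₁ (⨟ₘ-graph (Mod₁ χ) (pMod₁ [ χ ]) (pMod₁ θ) (pMod₁-[] χ) M'' M)

      from : pMod₁ θ (Mod₁ χ M'') M → (pMod₁ [ χ ] ⨟ₘ pMod₁ θ) M'' M
      from = proj₂ (⨟ₘ-graph (Mod₁ χ) (pMod₁ [ χ ]) (pMod₁ θ) (pMod₁-[] χ) M'' M)

mainTheorem6 : ∀ {o h s m ℓ : Level} (𝒮 : Setting o h s m ℓ) →
    let open ThreeHalves 𝒮 in
    ∀ {S' S''} (χ : Hom S' S'') → IsPModStrict [ χ ]
mainTheorem6 𝒮 = Strictness.[_]-isPModStrict 𝒮
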